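{- Let $n\ge 2$ be even and $m>1$ an integer, and let $G$ be a non-regular bipartite graph of order $m$ in which all vertices of each partite set have the same degree. Then $\chi_{ld}(G[\overline{K_n}])=2$.
   Context: For a graph $G=(V,E)$ of order $N$ and a bijection $f\colon V\to\{1,\dots,N\}$, the weight of a vertex $u$ is $w(u)=\sum_{x\in N(u)}f(x)$, where $N(u)$ is the open neighborhood of $u$. The bijection $f$ is a local distance antimagic labeling if $w(u)\neq w(v)$ for every edge $uv$. $\chi_{ld}(G)$ is the minimum number of distinct weights over all local distance antimagic labelings of $G$. $\overline{K_n}$ is the edgeless graph on $n$ vertices. The lexicographic product $G[H]$ has vertex set $V(G)\times V(H)$, with $(g,h)$ adjacent to $(g',h')$ iff $gg'\in E(G)$, or $g=g'$ and $hh'\in E(H)$. -}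

module Defs where

open import Data.Nat using (ℕ; zero; suc; _+_; _*_; _≤_)
open import Data.Nat.Properties using (_≟_)
open import Data.Bool using (Bool; true; false; if_then_else_; _∨_; _∧_)
open import Data.Fin using (Fin; toℕ; remQuot)
import Data.Fin.Properties as FinP
open import Data.List using (List; map; length; deduplicate)
open import Data.Nat.ListAction using (sum)
open import Data.List.Base using (allFin)
open import Data.Product using (Σ; _×_; _,_; proj₁; proj₂; ∃)
open import Relation.Nullary using (¬_; does)
open import Relation.Binary.PropositionalEquality using (_≡_; _≢_)
open import Function.Definitions using (Bijective)

Graph : ℕ → Set
Graph N = Fin N → Fin N → Bool

IsSimple : ∀ {N} → Graph N → Set
IsSimple {N} G = (∀ u v → G u v ≡ G v u) × (∀ u → G u u ≡ false)

Σv : ∀ {N} → (Fin N → ℕ) → ℕ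
Σv {N} g = sum (map g (allFin N))

degree : ∀ {N} → Graph N → Fin N → ℕ
degree G u = Σv (λ v → if G u v then 1 else 0)

IsRegular : ∀ {N} → Graph N → Set
IsRegular G = ∃ λ d → ∀ u → degree G u ≡ d

IsBipartiteEqualDegreeParts : ∀ {N} → Graph N → Set
IsBipartiteEqualDegreeParts {N} G =
  Σ (Fin N → Bool) λ side →
    (∀ u v → G u v ≡ true → side u ≢ side v) ×
    (∀ u v → side u ≡ side v → degree G u ≡ degree G v)

emptyGraph : (n : ℕ) → Graph n
emptyGraph n _ _ = false

-- lexicographic product G[H]; vertex (g , h) is encoded by combine g h : Fin (m * n)
lex : ∀ {m n} → Graph m → Graph n → Graph (m * n)
lex {m} {n} G H x y =
  let gx = proj₁ (remQuot {m} n x) ; hx = proj₂ (remQuot {m} n x)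
      gy = proj₁ (remQuot {m} n y) ; hy = proj₂ (remQuot {m} n y)
  in G gx gy ∨ (does (gx FinP.≟ gy) ∧ H hx hy)

-- a labeling f assigns label suc (toℕ (f v)) ∈ {1,…,N}; it must be a bijection
IsLabeling : ∀ {N} → (Fin N → Fin N) → Set
IsLabeling f = Bijective _≡_ _≡_ f

label : ∀ {N} → (Fin N → Fin N) → Fin N → ℕ
label f v = suc (toℕ (f v))

weight : ∀ {N} → Graph N → (Fin N → Fin N) → Fin N → ℕ
weight G f u = Σv (λ v → if G u v then label f v else 0)

IsLocalDistanceAntimagic : ∀ {N} → Graph N → (Fin N → Fin N) → Set
IsLocalDistanceAntimagic G f =
  IsLabeling f × (∀ u v → G u v ≡ true → weight G f u ≢ weight G f v)

numWeights : ∀ {N} → Graph N → (Fin N → Fin N) → ℕ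
numWeights {N} G f = length (deduplicate _≟_ (map (weight G f) (allFin N)))

-- χ_ld(G) = k : k is the minimum number of distinct weights over all
-- local distance antimagic labelings of G (attained).
ChiLdEq : ∀ {N} → Graph N → ℕ → Set
ChiLdEq G k =
  (Σ _ λ f → IsLocalDistanceAntimagic G f × numWeights G f ≡ k) ×
  (∀ f → IsLocalDistanceAntimagic G f → k ≤ numWeights G f)

{-# OPTIONS --safe #-}
module Submission where

-- In G[K̄ₙ] the vertex (g, h) is adjacent exactly to the fibres over the neighbours of g, so if
-- every fibre {g} × K̄ₙ carries the same label sum C then w(g, h) = C · deg g.  For n = 2k the
-- labeling (g, h) ↦ n·g + h + 1 for h < k and (g, h) ↦ n·(m−1−g) + h + 1 for h ≥ k has this
-- property, since the labels at h and h + k add up to a value independent of g.  A non-regular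
-- bipartite graph whose sides are regular has two degrees, attained on the two sides, hence
-- exactly two weights with adjacent vertices weighted differently; and an antimagic labeling of
-- a graph with an edge always has at least two weights.

open import Defs
open import Data.Nat using (ℕ; zero; suc; _+_; _*_; _≤_; pred; s≤s; z≤n; NonZero)
open import Data.Nat.Properties
  using (+-*-semiring; _≟_; +-assoc; +-identityʳ; *-identityʳ; *-zeroʳ; *-cancelˡ-≡; m+[n∸m]≡n; ≤-antisym)
open import Data.Nat.Tactic.RingSolver using (solve-∀)
open import Algebra.Properties.Semiring.Sum +-*-semiring
  using (sum; sum-syntax; sum-cong-≗; sum-replicate-zero; ∑-distrib-+; *-distribˡ-sum)
open import Data.Bool using (Bool; true; false; if_then_else_; _∨_) renaming (_≟_ to _≟ᵇ_)
open import Data.Bool.Properties using (∧-zeroʳ; ∨-identityʳ)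
open import Data.Fin using (Fin; zero; suc; toℕ; remQuot; quotient; remainder; combine; opposite; _↑ˡ_; _↑ʳ_)
open import Data.Fin.Properties using (remQuot-combine; combine-remQuot; toℕ-combine; opposite-prop; opposite-involutive; toℕ<n; any?)
open import Data.List using (List; []; _∷_; map; length; deduplicate; tabulate; allFin)
import Data.Nat.ListAction as ListAction
open import Data.List.Properties using (map-tabulate)
open import Data.List.Membership.Propositional using (_∈_)
open import Data.List.Membership.Propositional.Properties using (∈-map⁺; ∈-map⁻; ∈-allFin; ∈-deduplicate⁺; ∈-deduplicate⁻)
open import Data.List.Relation.Unary.Any using (here; there)
open import Data.List.Relation.Unary.All using (_∷_)
open import Data.List.Relation.Unary.AllPairs using (_∷_)
open import Data.List.Relation.Unary.Unique.Propositional using (Unique)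
open import Data.List.Relation.Unary.Unique.DecPropositional.Properties _≟_ using (deduplicate-!)
open import Data.Product using (_×_; _,_; proj₁; ∃; ∃₂)
open import Data.Sum using (_⊎_; inj₁; inj₂; [_,_]′)
import Data.Sum as Sum
open import Data.Empty using (⊥; ⊥-elim)
open import Function using (id; _∘_)
open import Function.Definitions using (Bijective)
open import Function.Consequences using (inverseᵇ⇒bijective)
open import Function.Consequences.Propositional using (strictlyInverseˡ⇒inverseˡ; strictlyInverseʳ⇒inverseʳ)
open import Relation.Nullary using (¬_; yes; no)
open import Relation.Binary.PropositionalEquality using (_≡_; _≢_; refl; sym; trans; cong; cong₂; subst; module ≡-Reasoning)

Σv≡∑ : ∀ {N} (g : Fin N → ℕ) → Σv g ≡ ∑[ i < N ] g i
Σv≡∑ {N} g = trans (cong ListAction.sum (map-tabulate id g)) (sum-tabulate N g)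
  where
  sum-tabulate : ∀ n (h : Fin n → ℕ) → ListAction.sum (tabulate h) ≡ sum h
  sum-tabulate zero    h = refl
  sum-tabulate (suc n) h = cong (h zero +_) (sum-tabulate n (h ∘ suc))

∑-↑ : ∀ m n (f : Fin (m + n) → ℕ) → ∑[ i < m + n ] f i ≡ ∑[ i < m ] f (i ↑ˡ n) + ∑[ j < n ] f (m ↑ʳ j)
∑-↑ zero    n f = refl
∑-↑ (suc m) n f = trans (cong (f zero +_) (∑-↑ m n (f ∘ suc))) (sym (+-assoc (f zero) _ _))

∑-combine : ∀ m n (f : Fin (m * n) → ℕ) → ∑[ i < m * n ] f i ≡ ∑[ g < m ] ∑[ h < n ] f (combine g h)
∑-combine zero    n f = refl
∑-combine (suc m) n f = trans (∑-↑ n (m * n) f) (cong (∑[ h < n ] f (h ↑ˡ m * n) +_) (∑-combine m n (f ∘ (n ↑ʳ_))))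

module _ {A : Set} where

  ∈∧∈∧≢⇒2≤length : ∀ {a b : A} {xs} → a ∈ xs → b ∈ xs → a ≢ b → 2 ≤ length xs
  ∈∧∈∧≢⇒2≤length (here refl) (here refl)    a≢b = ⊥-elim (a≢b refl)
  ∈∧∈∧≢⇒2≤length {xs = _ ∷ _ ∷ _} _ _ _ = s≤s (s≤s z≤n)
  ∈∧∈∧≢⇒2≤length {xs = _ ∷ []} (here _) (there ()) _
  ∈∧∈∧≢⇒2≤length {xs = _ ∷ []} (there ()) _ _

  no-three-distinct : ∀ {a b x y z : A} → x ≡ a ⊎ x ≡ b → y ≡ a ⊎ y ≡ b → z ≡ a ⊎ z ≡ b →
                      x ≢ y → x ≢ z → y ≢ z → ⊥
  no-three-distinct (inj₁ refl) (inj₁ refl) _           x≢y _   _   = x≢y refl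
  no-three-distinct (inj₂ refl) (inj₂ refl) _           x≢y _   _   = x≢y refl
  no-three-distinct (inj₁ refl) (inj₂ refl) (inj₁ refl) _   x≢z _   = x≢z refl
  no-three-distinct (inj₁ refl) (inj₂ refl) (inj₂ refl) _   _   y≢z = y≢z refl
  no-three-distinct (inj₂ refl) (inj₁ refl) (inj₁ refl) _   _   y≢z = y≢z refl
  no-three-distinct (inj₂ refl) (inj₁ refl) (inj₂ refl) _   x≢z _   = x≢z refl

  unique⇒length≤2 : ∀ {a b : A} {xs} → Unique xs → (∀ {x} → x ∈ xs → x ≡ a ⊎ x ≡ b) → length xs ≤ 2
  unique⇒length≤2 {xs = []}              _ _ = z≤n
  unique⇒length≤2 {xs = _ ∷ []}          _ _ = s≤s z≤n
  unique⇒length≤2 {xs = _ ∷ _ ∷ []}      _ _ = s≤s (s≤s z≤n)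
  unique⇒length≤2 {xs = _ ∷ _ ∷ _ ∷ _} ((x≢y ∷ x≢z ∷ _) ∷ (y≢z ∷ _) ∷ _) ⊆ab =
    ⊥-elim (no-three-distinct (⊆ab (here refl)) (⊆ab (there (here refl))) (⊆ab (there (there (here refl))))
                              x≢y x≢z y≢z)

module _ {N : ℕ} (G : Graph N) (f : Fin N → Fin N) where

  private
    weights : List ℕ
    weights = map (weight G f) (allFin N)

    weight∈ : ∀ u → weight G f u ∈ weights
    weight∈ u = ∈-map⁺ (weight G f) (∈-allFin u)

  2≤numWeights : ∀ {u v} → weight G f u ≢ weight G f v → 2 ≤ numWeights G f
  2≤numWeights {u} {v} wu≢wv =
    ∈∧∈∧≢⇒2≤length (∈-deduplicate⁺ _≟_ (weight∈ u)) (∈-deduplicate⁺ _≟_ (weight∈ v)) wu≢wv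

  numWeights≡2 : ∀ {u v} → weight G f u ≢ weight G f v →
                 (∀ x → weight G f x ≡ weight G f u ⊎ weight G f x ≡ weight G f v) → numWeights G f ≡ 2
  numWeights≡2 {u} {v} wu≢wv twoValued = ≤-antisym
    (unique⇒length≤2 (deduplicate-! weights) (λ p → twoValued′ (∈-deduplicate⁻ _≟_ weights p)))
    (2≤numWeights wu≢wv)
    where
    twoValued′ : ∀ {w} → w ∈ weights → w ≡ weight G f u ⊎ w ≡ weight G f v
    twoValued′ p with ∈-map⁻ (weight G f) p
    ... | x , _ , refl = twoValued x

degree≡∑ : ∀ {N} (G : Graph N) u → degree G u ≡ ∑[ v < N ] (if G u v then 1 else 0)
degree≡∑ G u = Σv≡∑ (λ v → if G u v then 1 else 0)

nonRegular⇒edge : ∀ {N} (G : Graph N) → ¬ IsRegular G → ∃₂ λ a b → G a b ≡ true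
nonRegular⇒edge {N} G nonRegular with any? (λ a → any? (λ b → G a b ≟ᵇ true))
... | yes edge = edge
... | no noEdge =
  ⊥-elim (nonRegular (0 , λ u → trans (degree≡∑ G u) (trans (sum-cong-≗ (isolated u)) (sum-replicate-zero N))))
  where
  isolated : ∀ u v → (if G u v then 1 else 0) ≡ 0
  isolated u v with G u v in uv
  ... | true  = ⊥-elim (noEdge (u , v , uv))
  ... | false = refl

≢⇒≡⊎≡ : ∀ {x y : Bool} → x ≢ y → ∀ z → z ≡ x ⊎ z ≡ y
≢⇒≡⊎≡ {false} {false} x≢y _     = ⊥-elim (x≢y refl)
≢⇒≡⊎≡ {true}  {true}  x≢y _     = ⊥-elim (x≢y refl)
≢⇒≡⊎≡ {false} {true}  _   false = inj₁ refl
≢⇒≡⊎≡ {false} {true}  _   true  = inj₂ refl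
≢⇒≡⊎≡ {true}  {false} _   false = inj₂ refl
≢⇒≡⊎≡ {true}  {false} _   true  = inj₁ refl

degree-two-valued : ∀ {N} {G : Graph N} → IsBipartiteEqualDegreeParts G →
                    ∀ {a b} → G a b ≡ true → ∀ u → degree G u ≡ degree G a ⊎ degree G u ≡ degree G b
degree-two-valued (side , sidesDiffer , sameDegree) {a} {b} ab u =
  Sum.map (sameDegree u a) (sameDegree u b) (≢⇒≡⊎≡ (sidesDiffer a b ab) (side u))

adjacent⇒degree≢ : ∀ {N} {G : Graph N} → IsBipartiteEqualDegreeParts G → ¬ IsRegular G →
                   ∀ {a b} → G a b ≡ true → degree G a ≢ degree G b
adjacent⇒degree≢ {G = G} bipartite nonRegular {a} ab da≡db =
  nonRegular (degree G a , λ u → [ id , (λ ub → trans ub (sym da≡db)) ]′ (degree-two-valued bipartite ab u))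

quotient-combine : ∀ {m n} (g : Fin m) (h : Fin n) → quotient n (combine g h) ≡ g
quotient-combine g h = cong proj₁ (remQuot-combine g h)

module _ {m n : ℕ} (G : Graph m) where

  lex-emptyGraph : ∀ x y → lex G (emptyGraph n) x y ≡ G (quotient n x) (quotient n y)
  lex-emptyGraph x y = trans (cong (G (quotient n x) (quotient n y) ∨_) (∧-zeroʳ _)) (∨-identityʳ _)

  lex-emptyGraph-combine : ∀ x g h → lex G (emptyGraph n) x (combine g h) ≡ G (quotient n x) g
  lex-emptyGraph-combine x g h = trans (lex-emptyGraph x (combine g h)) (cong (G (quotient n x)) (quotient-combine g h))

  lex-emptyGraph-edge : ∀ {a b} → G a b ≡ true → ∀ h → lex G (emptyGraph n) (combine a h) (combine b h) ≡ true
  lex-emptyGraph-edge {a} {b} ab h =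
    trans (lex-emptyGraph-combine (combine a h) b h) (trans (cong (λ g → G g b) (quotient-combine a h)) ab)

  weight-lex-emptyGraph : ∀ {f C} → (∀ (g : Fin m) → ∑[ h < n ] label f (combine g h) ≡ C) →
                          ∀ x → weight (lex G (emptyGraph n)) f x ≡ C * degree G (quotient n x)
  weight-lex-emptyGraph {f} {C} fibreSum x = begin
    weight (lex G (emptyGraph n)) f x
      ≡⟨ Σv≡∑ {m * n} _ ⟩
    ∑[ y < m * n ] (if lex G (emptyGraph n) x y then label f y else 0)
      ≡⟨ ∑-combine m n _ ⟩
    ∑[ g < m ] ∑[ h < n ] (if lex G (emptyGraph n) x (combine g h) then label f (combine g h) else 0)
      ≡⟨ sum-cong-≗ fibre ⟩
    ∑[ g < m ] (C * (if G (quotient n x) g then 1 else 0))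
      ≡⟨ *-distribˡ-sum {m} C _ ⟨
    C * ∑[ g < m ] (if G (quotient n x) g then 1 else 0)
      ≡⟨ cong (C *_) (degree≡∑ G (quotient n x)) ⟨
    C * degree G (quotient n x) ∎
    where
    open ≡-Reasoning
    fibre : ∀ g → ∑[ h < n ] (if lex G (emptyGraph n) x (combine g h) then label f (combine g h) else 0)
                ≡ C * (if G (quotient n x) g then 1 else 0)
    fibre g = trans (sum-cong-≗ (λ h → cong (if_then label f (combine g h) else 0) (lex-emptyGraph-combine x g h)))
                    (byAdjacency (G (quotient n x) g))
      where
      byAdjacency : ∀ b → ∑[ h < n ] (if b then label f (combine g h) else 0) ≡ C * (if b then 1 else 0)
      byAdjacency true  = trans (fibreSum g) (sym (*-identityʳ C))
      byAdjacency false = trans (sum-replicate-zero n) (sym (*-zeroʳ C))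

involutive⇒bijective : ∀ {A : Set} (f : A → A) → (∀ x → f (f x) ≡ x) → Bijective _≡_ _≡_ f
involutive⇒bijective f inv =
  inverseᵇ⇒bijective _≡_ refl sym trans (strictlyInverseˡ⇒inverseˡ f inv , strictlyInverseʳ⇒inverseʳ f inv)

module _ {m n : ℕ} (σ : Fin n → Fin m → Fin m) where

  fibrewise : Fin (m * n) → Fin (m * n)
  fibrewise x = combine (σ (remainder {m} n x) (quotient n x)) (remainder {m} n x)

  fibrewise-combine : ∀ g h → fibrewise (combine g h) ≡ combine (σ h g) h
  fibrewise-combine g h = cong (λ (g′ , h′) → combine (σ h′ g′) h′) (remQuot-combine {m} {n} g h)

  fibrewise-involutive : (∀ h g → σ h (σ h g) ≡ g) → ∀ x → fibrewise (fibrewise x) ≡ x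
  fibrewise-involutive inv x =
    subst (λ y → fibrewise (fibrewise y) ≡ y) (combine-remQuot {m} n x) (onCombine (remQuot {m} n x))
    where
    onCombine : ∀ ((g , h) : Fin m × Fin n) → fibrewise (fibrewise (combine g h)) ≡ combine g h
    onCombine (g , h) = begin
      fibrewise (fibrewise (combine g h)) ≡⟨ cong fibrewise (fibrewise-combine g h) ⟩
      fibrewise (combine (σ h g) h)       ≡⟨ fibrewise-combine (σ h g) h ⟩
      combine (σ h (σ h g)) h             ≡⟨ cong (λ g′ → combine g′ h) (inv h g) ⟩
      combine g h                         ∎
      where open ≡-Reasoning

toℕ+toℕ-opposite : ∀ {m} (g : Fin m) → toℕ g + toℕ (opposite g) ≡ pred m
toℕ+toℕ-opposite g = trans (cong (toℕ g +_) (opposite-prop g)) (cong pred (m+[n∸m]≡n (toℕ<n g)))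

module HalfReflecting (m k : ℕ) where

  reflectIf : Fin 2 → Fin m → Fin m
  reflectIf zero    = id
  reflectIf (suc _) = opposite

  reflectUpperHalf : Fin (2 * k) → Fin m → Fin m
  reflectUpperHalf h = reflectIf (quotient k h)

  reflectIf-involutive : ∀ b g → reflectIf b (reflectIf b g) ≡ g
  reflectIf-involutive zero    g = refl
  reflectIf-involutive (suc _) g = opposite-involutive g

  halfReflecting : Fin (m * (2 * k)) → Fin (m * (2 * k))
  halfReflecting = fibrewise reflectUpperHalf

  halfReflecting-bijective : IsLabeling halfReflecting
  halfReflecting-bijective =
    involutive⇒bijective halfReflecting (fibrewise-involutive reflectUpperHalf (reflectIf-involutive ∘ quotient k))

  label-halfReflecting : ∀ g (b : Fin 2) (j : Fin k) →
    label halfReflecting (combine g (combine b j)) ≡ suc (2 * k * toℕ (reflectIf b g) + (k * toℕ b + toℕ j))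
  label-halfReflecting g b j = cong suc (begin
    toℕ (halfReflecting (combine g h))               ≡⟨ cong toℕ (fibrewise-combine reflectUpperHalf g h) ⟩
    toℕ (combine (reflectUpperHalf h g) h)           ≡⟨ toℕ-combine (reflectUpperHalf h g) h ⟩
    2 * k * toℕ (reflectUpperHalf h g) + toℕ h       ≡⟨ cong₂ (λ g′ t → 2 * k * toℕ g′ + t)
                                                               (cong (λ b′ → reflectIf b′ g) (quotient-combine b j))
                                                               (toℕ-combine b j) ⟩
    2 * k * toℕ (reflectIf b g) + (k * toℕ b + toℕ j) ∎)
    where
    open ≡-Reasoning
    h : Fin (2 * k)
    h = combine b j

  halfReflecting-fibreSum : ∀ g → ∑[ h < 2 * k ] label halfReflecting (combine g h)
                                ≡ ∑[ j < k ] (2 + (2 * k * pred m + (k + 2 * toℕ j)))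
  halfReflecting-fibreSum g = begin
    ∑[ h < 2 * k ] label halfReflecting (combine g h)  ≡⟨ ∑-combine 2 k _ ⟩
    ∑[ j < k ] L zero j + (∑[ j < k ] L (suc zero) j + 0) ≡⟨ cong (∑[ j < k ] L zero j +_) (+-identityʳ _) ⟩
    ∑[ j < k ] L zero j + ∑[ j < k ] L (suc zero) j      ≡⟨ ∑-distrib-+ (L zero) (L (suc zero)) ⟨
    ∑[ j < k ] (L zero j + L (suc zero) j)                ≡⟨ sum-cong-≗ pairSum ⟩
    ∑[ j < k ] (2 + (2 * k * pred m + (k + 2 * toℕ j)))  ∎
    where
    open ≡-Reasoning
    L : Fin 2 → Fin k → ℕ
    L b j = label halfReflecting (combine g (combine b j))

    pairSum : ∀ j → L zero j + L (suc zero) j ≡ 2 + (2 * k * pred m + (k + 2 * toℕ j))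
    pairSum j = begin
      L zero j + L (suc zero) j
        ≡⟨ cong₂ _+_ (label-halfReflecting g zero j) (label-halfReflecting g (suc zero) j) ⟩
      suc (2 * k * toℕ g + (k * 0 + toℕ j)) + suc (2 * k * toℕ (opposite g) + (k * 1 + toℕ j))
        ≡⟨ regroup (2 * k) k (toℕ g) (toℕ (opposite g)) (toℕ j) ⟩
      2 + (2 * k * (toℕ g + toℕ (opposite g)) + (k + 2 * toℕ j))
        ≡⟨ cong (λ s → 2 + (2 * k * s + (k + 2 * toℕ j))) (toℕ+toℕ-opposite g) ⟩
      2 + (2 * k * pred m + (k + 2 * toℕ j)) ∎
      where
      regroup : ∀ n k g g′ j → suc (n * g + (k * 0 + j)) + suc (n * g′ + (k * 1 + j)) ≡ 2 + (n * (g + g′) + (k + 2 * j))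
      regroup = solve-∀

module ConstantFibreSum {m n : ℕ} {G : Graph m} (nonRegular : ¬ IsRegular G) (bipartite : IsBipartiteEqualDegreeParts G)
                     {f : Fin (m * n) → Fin (m * n)} {C : ℕ} .{{_ : NonZero C}}
                     (fibreSum : ∀ (g : Fin m) → ∑[ h < n ] label f (combine g h) ≡ C) where

  private
    G′ : Graph (m * n)
    G′ = lex G (emptyGraph n)

    w : Fin (m * n) → ℕ
    w = weight G′ f

    w≡ : ∀ x → w x ≡ C * degree G (quotient n x)
    w≡ = weight-lex-emptyGraph G fibreSum

  adjacent⇒weight≢ : ∀ x y → G′ x y ≡ true → w x ≢ w y
  adjacent⇒weight≢ x y xy wx≡wy =
    adjacent⇒degree≢ bipartite nonRegular (trans (sym (lex-emptyGraph G x y)) xy)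
                     (*-cancelˡ-≡ _ _ C (trans (sym (w≡ x)) (trans wx≡wy (w≡ y))))

  weight-two-valued : ∀ {u v} → G′ u v ≡ true → ∀ x → w x ≡ w u ⊎ w x ≡ w v
  weight-two-valued {u} {v} uv x =
    Sum.map (sameWeight u) (sameWeight v)
            (degree-two-valued bipartite (trans (sym (lex-emptyGraph G u v)) uv) (quotient n x))
    where
    sameWeight : ∀ y → degree G (quotient n x) ≡ degree G (quotient n y) → w x ≡ w y
    sameWeight y dx≡dy = trans (w≡ x) (trans (cong (C *_) dx≡dy) (sym (w≡ y)))

chiLd-lex-emptyGraph≡2 : ∀ {m} k (G : Graph m) → ¬ IsRegular G → IsBipartiteEqualDegreeParts G →
                         ChiLdEq (lex G (emptyGraph (2 * suc k))) 2
chiLd-lex-emptyGraph≡2 {m} k G nonRegular bipartite with nonRegular⇒edge G nonRegular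
... | a , b , ab =
  (halfReflecting , (halfReflecting-bijective , adjacent⇒weight≢) ,
   numWeights≡2 _ _ (adjacent⇒weight≢ _ _ uv) (weight-two-valued uv)) ,
  λ f (_ , antimagic) → 2≤numWeights _ f (antimagic _ _ uv)
  where
  open HalfReflecting m (suc k)
  open ConstantFibreSum nonRegular bipartite {f = halfReflecting} halfReflecting-fibreSum
  uv : lex G (emptyGraph (2 * suc k)) (combine a zero) (combine b zero) ≡ true
  uv = lex-emptyGraph-edge G ab zero

mainTheorem7 : (n m : ℕ) → 2 ≤ n → (∃ λ k → n ≡ 2 * k) → 2 ≤ m →
    (G : Graph m) → IsSimple G → ¬ IsRegular G → IsBipartiteEqualDegreeParts G →
    ChiLdEq (lex G (emptyGraph n)) 2
mainTheorem7 .(2 * zero)  m () (zero  , refl) _ G _ nonRegular bipartite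
mainTheorem7 .(2 * suc k) m _  (suc k , refl) _ G _ nonRegular bipartite =
  chiLd-lex-emptyGraph≡2 k G nonRegular bipartite
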